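{- Let $\lambda(G)$ be a temporal graph, where $G=(V,E)$ is a (directed or undirected) graph, and let $s,v\in V$ be two distinguished nodes. Then the maximum number of pairwise out-disjoint journeys from $s$ to $v$ is equal to the minimum number of node departure times needed to separate $s$ from $v$.
   Context: A labeling of a (di)graph $G=(V,E)$ is a map $\lambda:E\to 2^{\mathbb{N}}$ assigning to each edge a finite (possibly empty) set of natural numbers (labels); $\lambda(G)$ is called a temporal graph. A time-edge is a triple $(u,w,t)$ with $(u,w)$ an edge (for undirected graphs, traversed from $u$ to $w$) and $t\in\lambda(\{u,w\})$; it leaves $u$ at time $t$ and arrives at $w$ at time $t$. A journey from $s$ to $v$ is a path $(e_1,\dots,e_k)$ of $G$ from $s$ to $v$ together with labels $l_1<l_2<\dots<l_k$ with $l_i\in\lambda(e_i)$, i.e. a sequence of time-edges with strictly increasing times. Two journeys are out-disjoint if they never leave from the same node at the same time (i.e. they contain no time-edges $(u,w,t)$ and $(u,w',t)$ with the same $u$ and $t$). Removing the node departure time $(u,t)$ means removing label $t$ from all edges leaving $u$, i.e. deleting all time-edges that leave $u$ at time $t$. The minimum number of node departure times needed to separate $s$ from $v$ is the smallest number of node departure times whose removal leaves a temporal graph with no journey from $s$ to $v$. -}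

module Defs where

open import Data.Nat using (ℕ; _<_; _≤_)
open import Data.Fin using (Fin)
open import Data.Bool using (Bool; true)
open import Data.List using (List; []; _∷_; map; length)
open import Data.List.Membership.Propositional using (_∈_)
open import Data.List.Relation.Unary.All using (All)
open import Data.List.Relation.Unary.AllPairs using (AllPairs)
open import Data.List.Relation.Unary.Linked using (Linked)
open import Data.List.Relation.Unary.Unique.Propositional using (Unique)
open import Data.Product using (Σ; _×_; _,_)
open import Data.Empty using (⊥)
open import Relation.Nullary using (¬_)
open import Relation.Binary.PropositionalEquality using (_≡_)

-- A labeled (di)graph on the node set Fin n.
-- adj u w ≡ true  iff  (u , w) is an (ordered) edge of G;
-- labels u w is the finite set λ((u,w)) of labels of that edge
-- (only relevant when (u , w) is an edge).
-- An undirected graph {u,w} with label set L is represented by the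
-- two ordered pairs (u,w),(w,u), both with adjacency true and label set L.
record TemporalGraph (n : ℕ) : Set where
  field
    adj    : Fin n → Fin n → Bool
    labels : Fin n → Fin n → List ℕ
open TemporalGraph public

-- Time-edge (u , w , t): leaves u at time t, arrives at w at time t.
record TimeEdge (n : ℕ) : Set where
  constructor te
  field
    from : Fin n
    to   : Fin n
    time : ℕ
open TimeEdge public

DepartureTime : ℕ → Set
DepartureTime n = Fin n × ℕ

Present : ∀ {n} → TemporalGraph n → List (DepartureTime n) → TimeEdge n → Set
Present G D e =
  (adj G (from e) (to e) ≡ true) × (time e ∈ labels G (from e) (to e))
    × ¬ ((from e , time e) ∈ D)

data Walk {n} (G : TemporalGraph n) (D : List (DepartureTime n)) :
          Fin n → Fin n → List (TimeEdge n) → Set where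
  []  : ∀ {x} → Walk G D x x []
  _∷_ : ∀ {x y e es} → Present G D e × from e ≡ x →
        Walk G D (to e) y es → Walk G D x y (e ∷ es)

_<ₜ_ : ∀ {n} → TimeEdge n → TimeEdge n → Set
e <ₜ e' = time e < time e'

Journey : ∀ {n} → TemporalGraph n → List (DepartureTime n) →
          Fin n → Fin n → List (TimeEdge n) → Set
Journey G D s v es =
  Walk G D s v es × Linked _<ₜ_ es × Unique (s ∷ map to es)

OutDisjoint : ∀ {n} → List (TimeEdge n) → List (TimeEdge n) → Set
OutDisjoint j j' = ∀ {e e'} → e ∈ j → e' ∈ j' →
  from e ≡ from e' → time e ≡ time e' → ⊥

OutDisjointJourneys : ∀ {n} → TemporalGraph n → Fin n → Fin n →
                      List (List (TimeEdge n)) → Set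
OutDisjointJourneys G s v js =
  All (Journey G [] s v) js × AllPairs OutDisjoint js

Separates : ∀ {n} → TemporalGraph n → Fin n → Fin n →
            List (DepartureTime n) → Set
Separates G s v D =
  Unique D × (∀ es → ¬ Journey G D s v es)

module Submission where

-- Build the static expansion of λ(G): a digraph whose vertices are departure times
-- (u , t), with an arc (u , t) → (w , t') whenever a time-edge (u , w , t) can be followed by
-- a time-edge leaving w at t' > t.  Journeys from s to v correspond to paths from departures
-- at s to departures of time-edges into v (a path of the expansion unfolds into a walk with
-- increasing times, which contains a journey by loop erasure), and out-disjoint journeys to
-- vertex-disjoint paths.  Menger's theorem for finite digraphs (proved here by Göring's
-- induction on the number of arcs) gives k disjoint paths and a separator of k vertices;
-- these are k out-disjoint journeys and k separating departure times.  Conversely, weak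
-- duality (out-disjoint journeys use distinct departure times of every separating set)
-- shows that neither can be improved.

open import Defs
open import Data.Nat using (ℕ; suc; _≤_; _<_; _<?_; z≤n; s≤s)
open import Data.Nat.Properties
  using (≤-refl; ≤-trans; ≤-reflexive; ≤-antisym; <-trans; <⇒≱; ≰⇒>; _≤?_) renaming (_≟_ to _≟ℕ_)
open import Data.Fin using (Fin) renaming (_≟_ to _≟F_)
open import Data.Bool using (true) renaming (_≟_ to _≟B_)
open import Data.List
  using (List; []; _∷_; _++_; length; map; filter; concatMap; cartesianProduct; allFin; deduplicate)
open import Data.List.Properties using (length-map; filter-notAll)
open import Data.List.Membership.Propositional using (_∈_; _∉_; find; lose; mapWith∈)
open import Data.List.Membership.Propositional.Properties
  using (∈-map⁺; ∈-map⁻; ∈-++⁺ˡ; ∈-++⁺ʳ; ∈-++⁻; ∈-filter⁺; ∈-filter⁻; ∈-map∘filter⁺; ∈-map∘filter⁻;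
         ∈-deduplicate⁺; ∈-deduplicate⁻; ∈-concatMap⁺; ∈-concatMap⁻;
         ∈-cartesianProduct⁺; ∈-cartesianProduct⁻; ∈-allFin)
open import Data.List.Relation.Binary.Subset.Propositional using (_⊆_)
open import Data.List.Relation.Binary.Subset.Propositional.Properties
  using (⊆-refl; ⊆-trans; ∷⁺ʳ; ∈-∷⁺ʳ; xs⊆ys++xs; All-resp-⊇)
open import Data.List.Relation.Binary.Disjoint.Propositional using (Disjoint)
open import Data.List.Relation.Unary.Any as Any using (Any; here; there; any?)
open import Data.List.Relation.Unary.All as All using (All; []; _∷_)
open import Data.List.Relation.Unary.All.Properties
  using (¬Any⇒All¬) renaming (++⁺ to All-++⁺; map⁺ to All-map⁺)
open import Data.List.Relation.Unary.AllPairs as AllPairs using (AllPairs; []; _∷_)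
open import Data.List.Relation.Unary.AllPairs.Properties using () renaming (map⁺ to AllPairs-map⁺)
open import Data.List.Relation.Unary.Linked
  using (Linked; []; [-]; _∷_) renaming (tail to linked-tail)
open import Data.List.Relation.Unary.Linked.Properties using (Linked⇒AllPairs)
open import Data.List.Relation.Unary.Unique.Propositional using (Unique)
open import Data.Product using (Σ; ∃; ∃₂; _×_; _,_; proj₁; proj₂)
open import Data.Product.Properties using (≡-dec)
open import Data.Sum using (_⊎_; inj₁; inj₂; [_,_]′)
open import Data.Empty using (⊥; ⊥-elim)
open import Function using (_∘_)
open import Relation.Nullary using (¬_; Dec; yes; no; ¬?; _×-dec_)
open import Relation.Binary.Definitions using (DecidableEquality)
open import Relation.Binary.PropositionalEquality
  using (_≡_; _≢_; refl; sym; trans; subst; subst₂; cong; cong₂; ≢-sym)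

-- Lists: counting distinct elements.

module _ {A : Set} where

  allPairs-lookup : ∀ {R : A → A → Set} {xs a b} → AllPairs R xs → a ∈ xs → b ∈ xs →
                    a ≡ b ⊎ R a b ⊎ R b a
  allPairs-lookup (_ ∷ _)     (here refl) (here refl) = inj₁ refl
  allPairs-lookup (ra ∷ _)    (here refl) (there b∈) = inj₂ (inj₁ (All.lookup ra b∈))
  allPairs-lookup (rb ∷ _)    (there a∈) (here refl) = inj₂ (inj₂ (All.lookup rb a∈))
  allPairs-lookup (_ ∷ rxs)   (there a∈) (there b∈) = allPairs-lookup rxs a∈ b∈

  linked-cons : ∀ {R : A → A → Set} {x xs} → All (R x) xs → Linked R xs → Linked R (x ∷ xs)
  linked-cons []       []  = [-]
  linked-cons (r ∷ _)  lk  = r ∷ lk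

  length-mapWith∈ : ∀ {B : Set} (xs : List A) (f : ∀ {x} → x ∈ xs → B) →
                    length (mapWith∈ xs f) ≡ length xs
  length-mapWith∈ []       f = refl
  length-mapWith∈ (x ∷ xs) f = cong suc (length-mapWith∈ xs (f ∘ there))

  allPairs-mapWith∈ : ∀ {B : Set} {R : B → B → Set} (xs : List A) (f : ∀ {x} → x ∈ xs → B) →
    Unique xs → (∀ {x x'} (m : x ∈ xs) (m' : x' ∈ xs) → x ≢ x' → R (f m) (f m')) →
    AllPairs R (mapWith∈ xs f)
  allPairs-mapWith∈ []       f []          rel = []
  allPairs-mapWith∈ {B} {R} (x ∷ xs) f (x∉ ∷ xs!) rel =
    All-mapWith∈ xs (λ m → rel (here refl) (there m) (All.lookup x∉ m))
    ∷ allPairs-mapWith∈ xs (f ∘ there) xs! (λ m m' → rel (there m) (there m'))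
    where
      All-mapWith∈ : ∀ ys {g : ∀ {y} → y ∈ ys → B} →
                     (∀ {y} (m : y ∈ ys) → R (f (here refl)) (g m)) →
                     All (R (f (here refl))) (mapWith∈ ys g)
      All-mapWith∈ []       r = []
      All-mapWith∈ (y ∷ ys) r = r (here refl) ∷ All-mapWith∈ ys (r ∘ there)

module Counting {A : Set} (_≟_ : DecidableEquality A) where
  open import Data.List.Membership.DecPropositional _≟_ using (_∈?_)

  without : A → List A → List A
  without x = filter (λ y → ¬? (y ≟ x))

  ∈-without : ∀ {x y ys} → y ∈ ys → y ≢ x → y ∈ without x ys
  ∈-without y∈ y≢x = ∈-filter⁺ (λ y → ¬? (y ≟ _)) y∈ y≢x

  without-shorter : ∀ {x ys} → x ∈ ys → length (without x ys) < length ys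
  without-shorter {ys = ys} x∈ =
    filter-notAll (λ y → ¬? (y ≟ _)) ys (Any.map (λ x≡y y≢x → y≢x (sym x≡y)) x∈)

  -- If R-related members of a family never hit a common point of D, and every member of a
  -- pairwise-R family hits D, the family has at most |D| members (the hit points are distinct).
  hitting-bound : ∀ {B : Set} {R : B → B → Set} {Hit : B → A → Set} {bs D} →
    (∀ {b b' a} → R b b' → Hit b a → Hit b' a → ⊥) → AllPairs R bs →
    All (λ b → ∃ λ a → a ∈ D × Hit b a) bs → length bs ≤ length D
  hitting-bound excl []           []                       = z≤n
  hitting-bound {R = R} {Hit} {D = D} excl (rel ∷ rels) ((a , a∈D , hit) ∷ hits) =
    ≤-trans (s≤s (hitting-bound excl rels (All.zipWith elsewhere (rel , hits)))) (without-shorter a∈D)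
    where
      -- the other members hit D away from a, since they are R-related to the first
      elsewhere : ∀ {b'} → R _ b' × (∃ λ a' → a' ∈ D × Hit b' a') →
                  ∃ λ a' → a' ∈ without a D × Hit b' a'
      elsewhere (r , a' , a'∈D , hit') = a' , ∈-without a'∈D (λ { refl → excl r hit hit' }) , hit'

  pigeonhole : ∀ {xs ys} → Unique xs → xs ⊆ ys → length xs ≤ length ys
  pigeonhole xs! sub = hitting-bound (λ x≢x' x≡a x'≡a → x≢x' (trans x≡a (sym x'≡a))) xs!
                                     (All.tabulate (λ m → _ , sub m , refl))

  cover : ∀ {xs ys} → Unique xs → xs ⊆ ys → length ys ≤ length xs → ys ⊆ xs
  cover {xs} {ys} xs! sub long {z} z∈ys with z ∈? xs
  ... | yes z∈xs = z∈xs
  ... | no  z∉xs = ⊥-elim (<⇒≱ (without-shorter z∈ys) (≤-trans long (pigeonhole xs! avoid-z)))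
    where
      avoid-z : xs ⊆ without z ys
      avoid-z x∈ = ∈-without (sub x∈) (λ { refl → z∉xs x∈ })

-- Paths in a relation R, indexed by their endpoints and their list of vertices.

infixr 5 _▸_

data Path {V : Set} (R : V → V → Set) : V → V → List V → Set where
  stop : ∀ {x} → Path R x x (x ∷ [])
  _▸_  : ∀ {x y z vs} → R x y → Path R y z vs → Path R x z (x ∷ vs)

module _ {V : Set} {R : V → V → Set} where

  start∈ : ∀ {a b vs} → Path R a b vs → a ∈ vs
  start∈ stop    = here refl
  start∈ (_ ▸ _) = here refl

  end∈ : ∀ {a b vs} → Path R a b vs → b ∈ vs
  end∈ stop    = here refl
  end∈ (_ ▸ p) = there (end∈ p)

  weaken : ∀ {R' : V → V → Set} → (∀ {x y} → R x y → R' x y) →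
           ∀ {a b vs} → Path R a b vs → Path R' a b vs
  weaken f stop    = stop
  weaken f (r ▸ p) = f r ▸ weaken f p

  restrict : ∀ {P : V → Set} {a b vs} → All P vs → Path R a b vs →
             Path (λ u w → R u w × P u × P w) a b vs
  restrict _          stop    = stop
  restrict (pa ∷ pvs) (r ▸ p) = (r , pa , All.lookup pvs (start∈ p)) ▸ restrict pvs p

  all-sources : ∀ {P : V → Set} → (∀ {x y} → R x y → P x) →
                ∀ {a b vs} → P b → Path R a b vs → All P vs
  all-sources f pb stop    = pb ∷ []
  all-sources f pb (r ▸ p) = f r ∷ all-sources f pb p

  all-targets : ∀ {P : V → Set} → (∀ {x y} → R x y → P y) →
                ∀ {a b vs} → P a → Path R a b vs → All P vs
  all-targets f pa stop    = pa ∷ []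
  all-targets f pa (r ▸ p) = pa ∷ all-targets f (f r) p

  only-end : ∀ {Q : V → Set} → (∀ {x y} → R x y → ¬ Q x) →
             ∀ {a b vs u} → Path R a b vs → u ∈ vs → Q u → u ≡ b
  only-end f stop    (here refl) q = refl
  only-end f (r ▸ p) (here refl) q = ⊥-elim (f r q)
  only-end f (r ▸ p) (there u∈)  q = only-end f p u∈ q

  only-start : ∀ {Q : V → Set} → (∀ {x y} → R x y → ¬ Q y) →
               ∀ {a b vs u} → Path R a b vs → u ∈ vs → Q u → u ≡ a
  only-start f stop    (here refl) q = refl
  only-start f (r ▸ p) (here refl) q = refl
  only-start f (r ▸ p) (there u∈)  q = ⊥-elim (f r (subst _ (only-start f p u∈ q) q))

  prefix-to : ∀ {a b vs u} → Path R a b vs → u ∈ vs → ∃ λ ws → Path R a u ws × ws ⊆ vs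
  prefix-to stop    (here refl) = _ , stop , ⊆-refl
  prefix-to (r ▸ p) (here refl) = _ , stop , ∈-∷⁺ʳ (here refl) (λ ())
  prefix-to (r ▸ p) (there u∈) with prefix-to p u∈
  ... | ws , q , ws⊆ = _ , r ▸ q , ∷⁺ʳ _ ws⊆

  suffix-from : ∀ {a b vs u} → Path R a b vs → u ∈ vs → ∃ λ ws → Path R u b ws × ws ⊆ vs
  suffix-from stop    (here refl) = _ , stop , ⊆-refl
  suffix-from (r ▸ p) (here refl) = _ , r ▸ p , ⊆-refl
  suffix-from (r ▸ p) (there u∈) with suffix-from p u∈
  ... | ws , q , ws⊆ = ws , q , there ∘ ws⊆

  join : ∀ {a w b vs₁ vs₂} → Path R a w vs₁ → Path R w b vs₂ →
         ∃ λ vs → Path R a b vs × vs ⊆ vs₁ ++ vs₂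
  join stop    q = _ , q , xs⊆ys++xs _ _
  join (r ▸ p) q with join p q
  ... | vs , pq , vs⊆ = _ , r ▸ pq , ∷⁺ʳ _ vs⊆

-- Menger's theorem for finite digraphs given by a list of arcs, in the A–B form:
-- there are disjoint A–B paths and an A–B separator of (at most, hence exactly) equal size.
-- The proof is by induction on the arc list (Göring's short proof).

module Menger {V : Set} (_≟_ : DecidableEquality V) where
  open import Data.List.Membership.DecPropositional _≟_ using (_∈?_)
  open import Data.List.Relation.Unary.Unique.DecPropositional.Properties _≟_ using (deduplicate-!)
  open Counting _≟_ using (cover)

  first-visit : ∀ (X : List V) {R : V → V → Set} {a b vs} → Path R a b vs → Any (_∈ X) vs →
    ∃₂ λ z ws → z ∈ X × Path (λ u w → R u w × u ∉ X) a z ws × ws ⊆ vs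
  first-visit X stop    (here a∈X) = _ , _ , a∈X , stop , ⊆-refl
  first-visit X stop    (there ())
  first-visit X (r ▸ p) (here a∈X) = _ , _ , a∈X , stop , ∈-∷⁺ʳ (here refl) (λ ())
  first-visit X {a = a} (r ▸ p) (there hit) with a ∈? X
  ... | yes a∈X = _ , _ , a∈X , stop , ∈-∷⁺ʳ (here refl) (λ ())
  ... | no  a∉X with first-visit X p hit
  ...   | z , ws , z∈X , q , ws⊆ = z , _ , z∈X , (r , a∉X) ▸ q , ∷⁺ʳ _ ws⊆

  last-visit : ∀ (Y : List V) {R : V → V → Set} {a b vs} → Path R a b vs → Any (_∈ Y) vs →
    ∃₂ λ z ws → z ∈ Y × Path (λ u w → R u w × w ∉ Y) z b ws × ws ⊆ vs
  last-visit Y stop (here b∈Y) = _ , _ , b∈Y , stop , ⊆-refl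
  last-visit Y stop (there ())
  last-visit Y (_▸_ {vs = vs} r p) hit with any? (_∈? Y) vs | hit
  ... | yes later | _ with last-visit Y p later
  ...   | z , ws , z∈Y , q , ws⊆ = z , ws , z∈Y , q , there ∘ ws⊆
  last-visit Y (_▸_ {vs = vs} r p) hit | no never | there later = ⊥-elim (never later)
  last-visit Y (_▸_ {vs = vs} r p) hit | no never | here a∈Y =
    _ , _ , a∈Y ,
    (r , All.lookup avoid (start∈ p)) ▸ weaken (λ (r , _ , w∉Y) → r , w∉Y) (restrict avoid p) ,
    ⊆-refl
    where avoid = ¬Any⇒All¬ vs never

  Blocks : (V → V → Set) → List V → List V → List V → Set
  Blocks R A B S = ∀ {a b vs} → a ∈ A → b ∈ B → Path R a b vs → All (_∉ S) vs → ⊥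

  module _ {R : V → V → Set} {A B : List V} where

    visits : ∀ {S a b vs} → Blocks R A B S → a ∈ A → b ∈ B → Path R a b vs → Any (_∈ S) vs
    visits {S} {vs = vs} S-blocks a∈ b∈ p with any? (_∈? S) vs
    ... | yes hit = hit
    ... | no miss = ⊥-elim (S-blocks a∈ b∈ p (¬Any⇒All¬ vs miss))

    blocks-⊆ : ∀ {S S'} → S ⊆ S' → Blocks R A B S → Blocks R A B S'
    blocks-⊆ S⊆ S-blocks a∈ b∈ p avoid = S-blocks a∈ b∈ p (All.map (_∘ S⊆) avoid)

    blocks-restrict : ∀ {R' S} → (∀ {u w} → R u w → u ∉ S → w ∉ S → R' u w) →
                      Blocks R' A B S → Blocks R A B S
    blocks-restrict emb S-blocks a∈ b∈ p avoid =
      S-blocks a∈ b∈ (weaken (λ (r , u∉ , w∉) → emb r u∉ w∉) (restrict avoid p)) avoid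

    -- If X separates A from B in R and the R-steps leaving the complement of X are
    -- R'-steps, then every A–X separator of R' separates A from B in R: cut a path at
    -- its first visit of X.
    blocks-before : ∀ {R' X T} → (∀ {u w} → R u w → u ∉ X → R' u w) →
                    Blocks R A B X → Blocks R' A X T → Blocks R A B T
    blocks-before {X = X} emb X-blocks T-blocks a∈ b∈ p avoid
      with first-visit X p (visits X-blocks a∈ b∈ p)
    ... | z , ws , z∈X , q , ws⊆ =
      T-blocks a∈ z∈X (weaken (λ (r , u∉) → emb r u∉) q) (All-resp-⊇ ws⊆ avoid)

    -- Symmetrically for Y–B separators, cutting at the last visit of Y.
    blocks-after : ∀ {R' Y T} → (∀ {u w} → R u w → w ∉ Y → R' u w) →
                   Blocks R A B Y → Blocks R' Y B T → Blocks R A B T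
    blocks-after {Y = Y} emb Y-blocks T-blocks a∈ b∈ p avoid
      with last-visit Y p (visits Y-blocks a∈ b∈ p)
    ... | z , ws , z∈Y , q , ws⊆ =
      T-blocks z∈Y b∈ (weaken (λ (r , w∉) → emb r w∉) q) (All-resp-⊇ ws⊆ avoid)

  record ABPath (R : V → V → Set) (A B : List V) : Set where
    constructor connect
    field
      {start end} : V
      {vertices}  : List V
      start∈A     : start ∈ A
      end∈B       : end ∈ B
      path        : Path R start end vertices
  open ABPath

  Apart : ∀ {R A B} → ABPath R A B → ABPath R A B → Set
  Apart p q = Disjoint (vertices p) (vertices q)

  shrink-apart : ∀ {R R' A A' B B' F} (f : ABPath R A B → ABPath R' A' B') →
    (∀ p → vertices (f p) ⊆ vertices p) → AllPairs Apart F → AllPairs Apart (map f F)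
  shrink-apart f f⊆ =
    AllPairs-map⁺ ∘ AllPairs.map (λ {p} {q} apart {_} (u∈p , u∈q) → apart (f⊆ p u∈p , f⊆ q u∈q))

  module Picking {R A B} (pick : ABPath R A B → V) (pick∈ : ∀ p → pick p ∈ vertices p)
                 {F : List (ABPath R A B)} (F-apart : AllPairs Apart F) where

    apart-if-picks-differ : ∀ {p q} → p ∈ F → q ∈ F → pick p ≢ pick q → Apart p q
    apart-if-picks-differ p∈ q∈ differ with allPairs-lookup F-apart p∈ q∈
    ... | inj₁ refl         = ⊥-elim (differ refl)
    ... | inj₂ (inj₁ apart) = apart
    ... | inj₂ (inj₂ apart) = λ (u∈p , u∈q) → apart (u∈q , u∈p)

    picks-cover : ∀ {Z} → Unique Z → (∀ p → pick p ∈ Z) → length Z ≤ length F →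
                  ∀ {z} → z ∈ Z → ∃ λ p → p ∈ F × z ≡ pick p
    picks-cover {Z} Z! pick∈Z big z∈Z =
      ∈-map⁻ pick (cover distinct picks⊆Z (≤-trans big (≤-reflexive (sym (length-map pick F)))) z∈Z)
      where
        distinct : Unique (map pick F)
        distinct = AllPairs-map⁺ (AllPairs.map (λ {p} {q} apart eq →
                     apart (pick∈ p , subst (_∈ vertices q) (sym eq) (pick∈ q))) F-apart)
        picks⊆Z : map pick F ⊆ Z
        picks⊆Z m with ∈-map⁻ pick m
        ... | p , _ , refl = pick∈Z p

  record Certificate (R : V → V → Set) (A B : List V) : Set where
    field
      family           : List (ABPath R A B)
      disjoint         : AllPairs Apart family
      separator        : List V
      separator-unique : Unique separator
      blocks           : Blocks R A B separator
      small            : length separator ≤ length family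
  open Certificate

  Arc : List (V × V) → V → V → Set
  Arc E u w = (u , w) ∈ E

  -- Without arcs, the paths are the single vertices of A ∩ B, which is also a separator.
  menger-no-arcs : ∀ A B → Certificate (Arc []) A B
  menger-no-arcs A B = record
    { family           = mapWith∈ S trivial
    ; disjoint         = allPairs-mapWith∈ S trivial S! trivial-apart
    ; separator        = S
    ; separator-unique = S!
    ; blocks           = S-blocks
    ; small            = ≤-reflexive (sym (length-mapWith∈ S trivial))
    }
    where
      S : List V
      S = deduplicate _≟_ (filter (_∈? A) B)

      S! : Unique S
      S! = deduplicate-! (filter (_∈? A) B)

      in-both : ∀ {z} → z ∈ S → z ∈ B × z ∈ A
      in-both z∈S = ∈-filter⁻ (_∈? A) {xs = B} (∈-deduplicate⁻ _≟_ (filter (_∈? A) B) z∈S)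

      trivial : ∀ {z} → z ∈ S → ABPath (Arc []) A B
      trivial z∈S = connect (proj₂ (in-both z∈S)) (proj₁ (in-both z∈S)) stop

      trivial-apart : ∀ {z z'} (m : z ∈ S) (m' : z' ∈ S) → z ≢ z' → Apart (trivial m) (trivial m')
      trivial-apart m m' z≢z' (here refl , here refl) = z≢z' refl

      S-blocks : Blocks (Arc []) A B S
      S-blocks a∈A b∈B stop     (a∉S ∷ []) = a∉S (∈-deduplicate⁺ _≟_ (∈-filter⁺ (_∈? A) b∈B a∈A))
      S-blocks a∈A b∈B (() ▸ _) _

  module AddArc (x y : V) (E : List (V × V)) (ih : ∀ A B → Certificate (Arc E) A B) where

    E⁺ : List (V × V)
    E⁺ = (x , y) ∷ E

    lift : ∀ {A B} → ABPath (Arc E) A B → ABPath (Arc E⁺) A B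
    lift p = connect (start∈A p) (end∈B p) (weaken there (path p))

    reuse : ∀ {A B T} (C : Certificate (Arc E) A B) → Unique T → Blocks (Arc E⁺) A B T →
            length T ≤ length (separator C) → Certificate (Arc E⁺) A B
    reuse C T! T-blocks T≤S = record
      { family           = map lift (family C)
      ; disjoint         = AllPairs-map⁺ (disjoint C)
      ; separator        = _
      ; separator-unique = T!
      ; blocks           = T-blocks
      ; small            = ≤-trans T≤S (≤-trans (small C)
                                                 (≤-reflexive (sym (length-map lift (family C)))))
      }

    arc-blocked : ∀ {A B S} → x ∈ S ⊎ y ∈ S → Blocks (Arc E) A B S → Blocks (Arc E⁺) A B S
    arc-blocked {S = S} x∈S⊎y∈S = blocks-restrict old-arc
      where
        old-arc : ∀ {u w} → Arc E⁺ u w → u ∉ S → w ∉ S → Arc E u w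
        old-arc (here refl) x∉S y∉S = ⊥-elim ([ x∉S , y∉S ]′ x∈S⊎y∈S)
        old-arc (there a)   _   _   = a

    -- Then X = x ∷ S and
    -- Y = y ∷ S separate A from B in E⁺, and the induction hypothesis is applied to the
    -- A–X and the Y–B problem in E.
    module Augment {A B} (C : Certificate (Arc E) A B)
                   (x∉S : x ∉ separator C) (y∉S : y ∉ separator C) where
      S X Y : List V
      S = separator C
      X = x ∷ S
      Y = y ∷ S

      X! : Unique X
      X! = ¬Any⇒All¬ S x∉S ∷ separator-unique C

      X-blocks : Blocks (Arc E⁺) A B X
      X-blocks = arc-blocked (inj₁ (here refl)) (blocks-⊆ there (blocks C))

      Y-blocks : Blocks (Arc E⁺) A B Y
      Y-blocks = arc-blocked (inj₂ (here refl)) (blocks-⊆ there (blocks C))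

      leaves-X : ∀ {u w} → Arc E⁺ u w → u ∉ X → Arc E u w
      leaves-X (here refl) x∉X = ⊥-elim (x∉X (here refl))
      leaves-X (there a)   _   = a

      enters-Y : ∀ {u w} → Arc E⁺ u w → w ∉ Y → Arc E u w
      enters-Y (here refl) y∉Y = ⊥-elim (y∉Y (here refl))
      enters-Y (there a)   _   = a

      -- If E has |X| disjoint A–X paths and |Y| disjoint Y–B paths, they glue (through S,
      -- and through the new arc from x to y) into |X| disjoint A–B paths of E⁺.
      module Glue (F₁ : List (ABPath (Arc E) A X)) (F₁-apart : AllPairs Apart F₁)
                  (F₁-big : length X ≤ length F₁)
                  (F₂ : List (ABPath (Arc E) Y B)) (F₂-apart : AllPairs Apart F₂)
                  (F₂-big : length Y ≤ length F₂) where

        Into : V → V → Set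
        Into u w = Arc E u w × u ∉ X

        OutOf : V → V → Set
        OutOf u w = Arc E u w × w ∉ Y

        cut-into : (p : ABPath (Arc E) A X) → Σ (ABPath Into A X) λ p' → vertices p' ⊆ vertices p
        cut-into p with first-visit X (path p) (lose (end∈ (path p)) (end∈B p))
        ... | _ , _ , z∈X , q , ws⊆ = connect (start∈A p) z∈X q , ws⊆

        cut-out : (q : ABPath (Arc E) Y B) → Σ (ABPath OutOf Y B) λ q' → vertices q' ⊆ vertices q
        cut-out q with last-visit Y (path q) (lose (start∈ (path q)) (start∈A q))
        ... | _ , _ , z∈Y , q' , ws⊆ = connect z∈Y (end∈B q) q' , ws⊆

        G₁ : List (ABPath Into A X)
        G₁ = map (proj₁ ∘ cut-into) F₁

        G₂ : List (ABPath OutOf Y B)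
        G₂ = map (proj₁ ∘ cut-out) F₂

        module Ends   = Picking {Into} {A} {X} end (λ p → end∈ (path p))
                                (shrink-apart (proj₁ ∘ cut-into) (λ p → proj₂ (cut-into p)) F₁-apart)
        module Starts = Picking {OutOf} {Y} {B} start (λ q → start∈ (path q))
                                (shrink-apart (proj₁ ∘ cut-out) (λ q → proj₂ (cut-out q)) F₂-apart)

        into : ∀ {z} → z ∈ X → ∃ λ p → p ∈ G₁ × z ≡ end p
        into = Ends.picks-cover X! end∈B (≤-trans F₁-big (≤-reflexive (sym (length-map _ F₁))))

        out-of : ∀ {z} → z ∈ Y → ∃ λ q → q ∈ G₂ × z ≡ start q
        out-of = Starts.picks-cover (¬Any⇒All¬ S y∉S ∷ separator-unique C) start∈A
                                    (≤-trans F₂-big (≤-reflexive (sym (length-map _ F₂))))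

        -- An A–X path and a Y–B path of these kinds can only share a vertex of S that
        -- ends the first and starts the second: otherwise they would combine to an
        -- A–B path of E avoiding S.
        meet : ∀ (p : ABPath Into A X) (q : ABPath OutOf Y B) {u} →
               u ∈ vertices p → u ∈ vertices q → u ∈ S × u ≡ end p × u ≡ start q
        meet p q {u} u∈p u∈q with u ∈? S
        ... | yes u∈S = u∈S , only-end proj₂ (path p) u∈p (there u∈S) ,
                        only-start proj₂ (path q) u∈q (there u∈S)
        ... | no  u∉S with prefix-to (path p) u∈p | suffix-from (path q) u∈q
        ...   | ws₁ , p' , _ | ws₂ , q' , _ with join (weaken proj₁ p') (weaken proj₁ q')
        ...     | _ , pq , ws⊆ =
          ⊥-elim (blocks C (start∈A p) (end∈B q) pq (All-resp-⊇ ws⊆ (All-++⁺ avoid₁ avoid₂)))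
          where
            avoid₁ : All (_∉ S) ws₁
            avoid₁ = all-sources (λ (_ , u∉X) → u∉X ∘ there) u∉S p'
            avoid₂ : All (_∉ S) ws₂
            avoid₂ = all-targets (λ (_ , w∉Y) → w∉Y ∘ there) u∉S q'

        -- Each z ∈ X continues at partner z ∈ Y: x through the new arc, S-vertices in place.
        partner : ∀ {z} → z ∈ X → V
        partner     (here _)  = y
        partner {z} (there _) = z

        partner∈Y : ∀ {z} (m : z ∈ X) → partner m ∈ Y
        partner∈Y (here _)   = here refl
        partner∈Y (there z∈S) = there z∈S

        partner-injective : ∀ {z z'} (m : z ∈ X) (m' : z' ∈ X) → z ≢ z' → partner m ≢ partner m'
        partner-injective (here refl) (here refl)  z≢z' _  = z≢z' refl
        partner-injective (here refl) (there z'∈S) _    eq = y∉S (subst (_∈ S) (sym eq) z'∈S)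
        partner-injective (there z∈S) (here refl)  _    eq = y∉S (subst (_∈ S) eq z∈S)
        partner-injective (there _)   (there _)    z≢z' eq = z≢z' eq

        partner-in-S : ∀ {z} (m : z ∈ X) → partner m ∈ S → partner m ≡ z
        partner-in-S (here _)  y∈S = ⊥-elim (y∉S y∈S)
        partner-in-S (there _) _   = refl

        data Link : V → V → Set where
          same : ∀ {u} → Link u u
          arc  : Link x y

        link : ∀ {z} (m : z ∈ X) → Link z (partner m)
        link (here refl) = arc
        link (there _)   = same

        glue : (p : ABPath Into A X) (q : ABPath OutOf Y B) → Link (end p) (start q) →
               Σ (ABPath (Arc E⁺) A B) λ c → vertices c ⊆ vertices p ++ vertices q
        glue (connect a∈A _ p) (connect _ b∈B q) same
          with join (weaken (there ∘ proj₁) p) (weaken (there ∘ proj₁) q)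
        ... | _ , pq , ws⊆ = connect a∈A b∈B pq , ws⊆
        glue (connect a∈A _ p) (connect _ b∈B q) arc
          with join (weaken (there ∘ proj₁) p) (here refl ▸ weaken (there ∘ proj₁) q)
        ... | _ , pq , ws⊆ = connect a∈A b∈B pq , ⊆-trans ws⊆ (absorb (end∈ p))
          where
            -- the vertex x reached by the new arc already lies on the first path
            absorb : ∀ {xs ys} → x ∈ xs → xs ++ (x ∷ ys) ⊆ xs ++ ys
            absorb {xs} x∈xs m with ∈-++⁻ xs m
            ... | inj₁ m'         = ∈-++⁺ˡ m'
            ... | inj₂ (here refl) = ∈-++⁺ˡ x∈xs
            ... | inj₂ (there m') = ∈-++⁺ʳ xs m'

        head-of : ∀ {z} → z ∈ X → ABPath Into A X
        head-of m = proj₁ (into m)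

        tail-of : ∀ {z} → z ∈ X → ABPath OutOf Y B
        tail-of m = proj₁ (out-of (partner∈Y m))

        head∈ : ∀ {z} (m : z ∈ X) → head-of m ∈ G₁
        head∈ m = proj₁ (proj₂ (into m))

        tail∈ : ∀ {z} (m : z ∈ X) → tail-of m ∈ G₂
        tail∈ m = proj₁ (proj₂ (out-of (partner∈Y m)))

        head-end : ∀ {z} (m : z ∈ X) → z ≡ end (head-of m)
        head-end m = proj₂ (proj₂ (into m))

        tail-start : ∀ {z} (m : z ∈ X) → partner m ≡ start (tail-of m)
        tail-start m = proj₂ (proj₂ (out-of (partner∈Y m)))

        glued : ∀ {z} (m : z ∈ X) →
                Σ (ABPath (Arc E⁺) A B) λ c → vertices c ⊆ vertices (head-of m) ++ vertices (tail-of m)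
        glued m = glue (head-of m) (tail-of m) (subst₂ Link (head-end m) (tail-start m) (link m))

        combined : ∀ {z} → z ∈ X → ABPath (Arc E⁺) A B
        combined m = proj₁ (glued m)

        crossing : ∀ {z z' u} (m : z ∈ X) (m' : z' ∈ X) → z ≢ z' →
                   u ∈ vertices (head-of m) → u ∈ vertices (tail-of m') → ⊥
        crossing {z} {z'} {u} m m' z≢z' u∈p u∈q with meet (head-of m) (tail-of m') u∈p u∈q
        ... | u∈S , u≡end , u≡start =
          z≢z' (trans z≡u (trans u≡partner (partner-in-S m' (subst (_∈ S) u≡partner u∈S))))
          where
            z≡u : z ≡ u
            z≡u = trans (head-end m) (sym u≡end)

            u≡partner : u ≡ partner m'
            u≡partner = trans u≡start (sym (tail-start m'))

        -- Combined paths of distinct z, z' ∈ X are disjoint: heads are disjoint (distinct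
        -- ends), tails are disjoint (distinct partners), and heads never meet other tails.
        combined-apart : ∀ {z z'} (m : z ∈ X) (m' : z' ∈ X) → z ≢ z' → Apart (combined m) (combined m')
        combined-apart m m' z≢z' (u∈ , u∈')
          with ∈-++⁻ _ (proj₂ (glued m) u∈) | ∈-++⁻ _ (proj₂ (glued m') u∈')
        ... | inj₁ a | inj₁ b = Ends.apart-if-picks-differ (head∈ m) (head∈ m')
                                  (λ same-end → z≢z' (trans (head-end m)
                                                        (trans same-end (sym (head-end m')))))
                                  (a , b)
        ... | inj₂ a | inj₂ b = Starts.apart-if-picks-differ (tail∈ m) (tail∈ m')
                                  (λ same-start → partner-injective m m' z≢z'
                                     (trans (tail-start m) (trans same-start (sym (tail-start m')))))
                                  (a , b)
        ... | inj₁ a | inj₂ b = crossing m m' z≢z' a b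
        ... | inj₂ a | inj₁ b = crossing m' m (≢-sym z≢z') b a

        certificate : Certificate (Arc E⁺) A B
        certificate = record
          { family           = mapWith∈ X combined
          ; disjoint         = allPairs-mapWith∈ X combined X! combined-apart
          ; separator        = X
          ; separator-unique = X!
          ; blocks           = X-blocks
          ; small            = ≤-reflexive (sym (length-mapWith∈ X combined))
          }

      -- Either an A–X or a Y–B separator of E is no larger than S (and then it blocks A from B
      -- in E⁺), or both families exceed |S| paths and glue into |X| paths.
      certificate : Certificate (Arc E⁺) A B
      certificate with ih A X | ih Y B
      ... | C₁ | C₂ with length (separator C₁) ≤? length S | length (separator C₂) ≤? length S
      ... | yes T₁≤S | _ =
        reuse C (separator-unique C₁) (blocks-before leaves-X X-blocks (blocks C₁)) T₁≤S
      ... | no _ | yes T₂≤S =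
        reuse C (separator-unique C₂) (blocks-after enters-Y Y-blocks (blocks C₂)) T₂≤S
      ... | no T₁>S | no T₂>S =
        Glue.certificate (family C₁) (disjoint C₁) (≤-trans (≰⇒> T₁>S) (small C₁))
                         (family C₂) (disjoint C₂) (≤-trans (≰⇒> T₂>S) (small C₂))

    certificate : ∀ A B → Certificate (Arc E⁺) A B
    certificate A B with ih A B
    ... | C with x ∈? separator C | y ∈? separator C
    ... | yes x∈S | _       = reuse C (separator-unique C) (arc-blocked (inj₁ x∈S) (blocks C)) ≤-refl
    ... | no _    | yes y∈S = reuse C (separator-unique C) (arc-blocked (inj₂ y∈S) (blocks C)) ≤-refl
    ... | no x∉S  | no y∉S  = Augment.certificate C x∉S y∉S

  menger : ∀ E A B → Certificate (Arc E) A B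
  menger []            = menger-no-arcs
  menger ((x , y) ∷ E) = AddArc.certificate x y E (menger E)

-- The static expansion of λ(G): its vertices are node departure times (u , t), with an arc
-- (u , t) → (w , t') whenever a time-edge (u , w , t) is followed by a time-edge leaving w at
-- a later time t'.

module StaticExpansion {n : ℕ} (G : TemporalGraph n) (s v : Fin n) where

  _≟ᵈ_ : DecidableEquality (DepartureTime n)
  _≟ᵈ_ = ≡-dec _≟F_ _≟ℕ_

  open Menger _≟ᵈ_ using (Arc; ABPath; Apart; Blocks)
  open import Data.List.Membership.DecPropositional (_≟F_ {n}) using (_∈?_)
  open import Data.List.Membership.DecPropositional _≟ᵈ_ using () renaming (_∈?_ to _∈ᵈ?_)
  open Counting _≟ᵈ_ using (hitting-bound)
  open ABPath

  departure : TimeEdge n → DepartureTime n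
  departure e = from e , time e

  edge? : (uw : Fin n × Fin n) → Dec (adj G (proj₁ uw) (proj₂ uw) ≡ true)
  edge? (u , w) = adj G u w ≟B true

  edges : List (Fin n × Fin n)
  edges = filter edge? (cartesianProduct (allFin n) (allFin n))

  labelled : Fin n × Fin n → List (TimeEdge n)
  labelled (u , w) = map (te u w) (labels G u w)

  timeEdges : List (TimeEdge n)
  timeEdges = concatMap labelled edges

  listed : ∀ {D e} → Present G D e → e ∈ timeEdges
  listed {e = te u w t} (uw-edge , t-label , _) =
    ∈-concatMap⁺ labelled (lose uw∈edges (∈-map⁺ (te u w) t-label))
    where
      uw∈edges : (u , w) ∈ edges
      uw∈edges = ∈-filter⁺ edge? (∈-cartesianProduct⁺ (∈-allFin u) (∈-allFin w)) uw-edge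

  listed-present : ∀ {e} → e ∈ timeEdges → Present G [] e
  listed-present e∈ with find (∈-concatMap⁻ labelled {xs = edges} e∈)
  ... | (u , w) , uw∈ , e∈uw
      with ∈-filter⁻ edge? {xs = cartesianProduct (allFin n) (allFin n)} uw∈ | ∈-map⁻ (te u w) e∈uw
  ...   | _ , uw-edge | t , t-label , refl = uw-edge , t-label , λ ()

  Consecutive : TimeEdge n × TimeEdge n → Set
  Consecutive (e , e') = to e ≡ from e' × time e < time e'

  consecutive? : (ee' : TimeEdge n × TimeEdge n) → Dec (Consecutive ee')
  consecutive? (e , e') = (to e ≟F from e') ×-dec (time e <? time e')

  departures : TimeEdge n × TimeEdge n → DepartureTime n × DepartureTime n
  departures (e , e') = departure e , departure e'

  arcs : List (DepartureTime n × DepartureTime n)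
  arcs = map departures (filter consecutive? (cartesianProduct timeEdges timeEdges))

  sources targets : List (DepartureTime n)
  sources = map departure (filter (λ e → from e ≟F s) timeEdges)
  targets = map departure (filter (λ e → to e ≟F v) timeEdges)

  arc⁺ : ∀ {e e'} → e ∈ timeEdges → e' ∈ timeEdges → Consecutive (e , e') →
         Arc arcs (departure e) (departure e')
  arc⁺ e∈ e'∈ c = ∈-map∘filter⁺ departures consecutive? (_ , ∈-cartesianProduct⁺ e∈ e'∈ , refl , c)

  arc⁻ : ∀ {d d'} → Arc arcs d d' →
         ∃₂ λ e e' → e ∈ timeEdges × Consecutive (e , e') × (d , d') ≡ departures (e , e')
  arc⁻ a with ∈-map∘filter⁻ departures consecutive? {xs = cartesianProduct timeEdges timeEdges} a
  ... | (e , e') , ee'∈ , eq , c = e , e' , proj₁ (∈-cartesianProduct⁻ timeEdges timeEdges ee'∈) , c , eq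

  source⁻ : ∀ {d} → d ∈ sources → proj₁ d ≡ s
  source⁻ d∈ with ∈-map∘filter⁻ departure (λ e → from e ≟F s) {xs = timeEdges} d∈
  ... | _ , _ , refl , from≡s = from≡s

  walk-end : ∀ {D x y} → Walk G D x y [] → x ≡ y
  walk-end [] = refl

  walk-avoids : ∀ {D x y es} → Walk G D x y es → All (λ e → departure e ∉ D) es
  walk-avoids []                        = []
  walk-avoids (((_ , _ , e∉D) , _) ∷ w) = e∉D ∷ walk-avoids w

  walk-survives : ∀ {D x y es} → Walk G [] x y es → All (λ e → departure e ∉ D) es →
                  Walk G D x y es
  walk-survives []                              []            = []
  walk-survives (((uw-edge , t-label , _) , from≡) ∷ w) (e∉D ∷ avoid) =
    ((uw-edge , t-label , e∉D) , from≡) ∷ walk-survives w avoid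

  unfold : ∀ {d d' vs} → Path (Arc arcs) d d' vs → d' ∈ targets →
    ∃₂ λ e es → departure e ≡ d × Walk G [] (proj₁ d) v (e ∷ es) × Linked _<ₜ_ (e ∷ es) ×
                All (λ e' → departure e' ∈ vs) (e ∷ es)
  unfold stop d∈ with ∈-map∘filter⁻ departure (λ e → to e ≟F v) {xs = timeEdges} d∈
  ... | e , e∈ , refl , to≡v =
    e , [] , refl , (listed-present e∈ , refl) ∷ subst (λ w → Walk G [] w v []) (sym to≡v) [] ,
    [-] , here refl ∷ []
  unfold (a ▸ p) d∈ with arc⁻ a
  ... | e , e' , e∈ , (to≡from , t<t') , refl with unfold p d∈
  ...   | e₀ , es , dep≡ , w , lk , on-path =
    e , e₀ ∷ es , refl ,
    (listed-present e∈ , refl) ∷ subst (λ u → Walk G [] u v (e₀ ∷ es)) (sym to≡from) w ,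
    subst (time e <_) (sym (cong proj₂ dep≡)) t<t' ∷ lk ,
    here refl ∷ All.map there on-path

  journey-from : ∀ {D x y es} → Journey G D y v es → x ∈ y ∷ map to es →
                 ∃ λ es' → Journey G D x v es' × es' ⊆ es
  journey-from j (here refl) = _ , j , ⊆-refl
  journey-from {es = _ ∷ _} ((_ ∷ w) , lk , (_ ∷ nodes!)) (there x∈)
    with journey-from (w , linked-tail lk , nodes!) x∈
  ... | es' , j , es'⊆ = es' , j , there ∘ es'⊆

  -- Loop erasure: a walk to v with increasing times contains a journey on a subset of its
  -- time-edges.  If the first node recurs on the erased rest, continue from there instead.
  loop-erase : ∀ {D x es} → Walk G D x v es → Linked _<ₜ_ es →
               ∃ λ es' → Journey G D x v es' × es' ⊆ es
  loop-erase [] _ = [] , ([] , [] , [] ∷ []) , ⊆-refl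
  loop-erase {x = x} {es = e ∷ es} (step ∷ w) lk with loop-erase w (linked-tail lk)
  ... | es' , (w' , lk' , nodes!) , es'⊆ with x ∈? to e ∷ map to es'
  ...   | yes x∈ with journey-from (w' , lk' , nodes!) x∈
  ...     | es'' , j , es''⊆ = es'' , j , there ∘ es'⊆ ∘ es''⊆
  loop-erase {x = x} {es = e ∷ es} (step ∷ w) lk | es' , (w' , lk' , nodes!) , es'⊆ | no x∉ =
    e ∷ es' , (step ∷ w' , linked-cons (All-resp-⊇ es'⊆ e-first) lk' , ¬Any⇒All¬ _ x∉ ∷ nodes!) ,
    ∷⁺ʳ e es'⊆
    where
      e-first : All (e <ₜ_) es
      e-first = AllPairs.head (Linked⇒AllPairs {R = _<ₜ_ {n}} <-trans lk)

  fold : ∀ {D x e es} → Walk G D x v (e ∷ es) → Linked _<ₜ_ (e ∷ es) →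
         ∃ λ d → d ∈ targets × Path (Arc arcs) (departure e) d (map departure (e ∷ es))
  fold {es = []} ((present , _) ∷ w) _ =
    _ , ∈-map∘filter⁺ departure (λ e → to e ≟F v) (_ , listed present , refl , walk-end w) , stop
  fold {es = _ ∷ _} ((present , _) ∷ w@((present' , from≡to) ∷ _)) (t<t' ∷ lk) with fold w lk
  ... | d , d∈ , p = d , d∈ , arc⁺ (listed present) (listed present') (sym from≡to , t<t') ▸ p

  expansion-separator : ∀ {S} → s ≢ v → Blocks (Arc arcs) sources targets S →
                        ∀ es → ¬ Journey G S s v es
  expansion-separator s≢v S-blocks []       (w , _ , _) = s≢v (walk-end w)
  expansion-separator s≢v S-blocks (e ∷ es) (w@((present , from≡s) ∷ _) , lk , _) with fold w lk
  ... | d , d∈ , p = S-blocks e-source d∈ p (All-map⁺ (walk-avoids w))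
    where
      e-source : departure e ∈ sources
      e-source = ∈-map∘filter⁺ departure (λ e → from e ≟F s) (e , listed present , refl , from≡s)

  journey-of : (P : ABPath (Arc arcs) sources targets) →
               ∃ λ j → Journey G [] s v j × All (λ e → departure e ∈ vertices P) j
  journey-of P with unfold (path P) (end∈B P)
  ... | e , es , _ , w , lk , on-path
      with loop-erase (subst (λ u → Walk G [] u v (e ∷ es)) (source⁻ (start∈A P)) w) lk
  ...   | j , J , j⊆ = j , J , All-resp-⊇ j⊆ on-path

  journeys-of : List (ABPath (Arc arcs) sources targets) → List (List (TimeEdge n))
  journeys-of = map (proj₁ ∘ journey-of)

  journeys-out-disjoint : ∀ {F} → AllPairs Apart F → OutDisjointJourneys G s v (journeys-of F)
  journeys-out-disjoint F-apart =
    All-map⁺ (All.tabulate (λ {P} _ → proj₁ (proj₂ (journey-of P)))) ,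
    AllPairs-map⁺ (AllPairs.map (λ {P} {Q} → out-disjoint {P} {Q}) F-apart)
    where
      out-disjoint : ∀ {P Q} → Apart P Q → OutDisjoint (proj₁ (journey-of P)) (proj₁ (journey-of Q))
      out-disjoint {P} {Q} apart e∈ e'∈ from≡ time≡ =
        apart (All.lookup (proj₂ (proj₂ (journey-of P))) e∈ ,
               subst (_∈ vertices Q) (sym (cong₂ _,_ from≡ time≡))
                     (All.lookup (proj₂ (proj₂ (journey-of Q))) e'∈))

  hits-separator : ∀ {D j} → Separates G s v D → Journey G [] s v j →
                   ∃ λ d → d ∈ D × d ∈ map departure j
  hits-separator {D} {j} (_ , no-journey) (w , lk , nodes!) with any? (λ e → departure e ∈ᵈ? D) j
  ... | no miss = ⊥-elim (no-journey j (walk-survives w (¬Any⇒All¬ j miss) , lk , nodes!))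
  ... | yes hit with find hit
  ...   | e , e∈j , e∈D = departure e , e∈D , ∈-map⁺ departure e∈j

  -- Weak duality: out-disjoint journeys never share a departure time, and each uses one of
  -- a separating set, so there are no more of them than departure times in the set.
  weak-duality : ∀ {js D} → OutDisjointJourneys G s v js → Separates G s v D → length js ≤ length D
  weak-duality (journeys , out-disjoint) D-separates =
    hitting-bound never-shared out-disjoint (All.map (hits-separator D-separates) journeys)
    where
      never-shared : ∀ {j j' d} → OutDisjoint j j' → d ∈ map departure j → d ∈ map departure j' → ⊥
      never-shared od d∈j d∈j' with ∈-map⁻ departure d∈j | ∈-map⁻ departure d∈j'
      ... | e , e∈ , refl | e' , e'∈ , same = od e∈ e'∈ (cong proj₁ same) (cong proj₂ same)

theorem3 : ∀ {n} (G : TemporalGraph n) (s v : Fin n) → s ≢ v →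
    Σ ℕ (λ k →
      Σ (List (List (TimeEdge n)))
        (λ js → length js ≡ k × OutDisjointJourneys G s v js)
      × (∀ js → OutDisjointJourneys G s v js → length js ≤ k)
      × Σ (List (DepartureTime n)) (λ D → length D ≡ k × Separates G s v D)
      × (∀ D → Separates G s v D → k ≤ length D))
theorem3 {n} G s v s≢v =
  length S , (js , js≡S , js-out-disjoint) , (λ _ od → weak-duality od S-separates) ,
  (S , refl , S-separates) ,
  (λ _ D-separates → subst (_≤ _) js≡S (weak-duality js-out-disjoint D-separates))
  where
    open StaticExpansion G s v
    open Menger _≟ᵈ_ using (module Certificate; menger)
    open Certificate (menger arcs sources targets)

    S : List (DepartureTime n)
    S = separator

    js : List (List (TimeEdge n))
    js = journeys-of family

    js-out-disjoint : OutDisjointJourneys G s v js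
    js-out-disjoint = journeys-out-disjoint disjoint

    S-separates : Separates G s v S
    S-separates = separator-unique , expansion-separator s≢v blocks

    js≡S : length js ≡ length S
    js≡S = ≤-antisym (weak-duality js-out-disjoint S-separates)
                     (≤-trans small (≤-reflexive (sym (length-map (proj₁ ∘ journey-of) family))))
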